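{- Let $\lambda$ be a partition, $n\in N(\lambda)$ and $k\ge1$. Then the polynomial $\mathrm{ss}_{\lambda,n}(x_1,\dots,x_k)$ has saturated Newton polytope, i.e. $\mathrm{New}(f)\cap\mathbb Z_{\ge0}^k=\mathrm{supp}\,f$ for $f=\mathrm{ss}_{\lambda,n}(x_1,\dots,x_k)$.
   Context: $N(\lambda)=\{n\ge|\lambda|: n\equiv|\lambda|\pmod 2\}$. For $f=\sum_a c_ax^a\in\mathbb Z[x_1,\dots,x_k]$, $\mathrm{supp}\,f=\{a\in\mathbb Z_{\ge0}^k: c_a\ne0\}$ and $\mathrm{New}(f)\subseteq\mathbb R^k$ is the convex hull of $\mathrm{supp}\,f$. A skew shape is a horizontal strip if it has at most one box in each column. An SSOT of shape $\lambda$ is a sequence of partitions $S=(S^1,S'^2,S^2,S'^3,\dots)$ such that, with $S^0=S'^1=\emptyset$: for all $i\ge1$, $S'^i\subseteq S^{i-1}$, $S'^i\subseteq S^i$, and $S^{i-1}/S'^i$, $S^i/S'^i$ are horizontal strips (possibly empty); and $S^i=S'^{i+1}=\lambda$ for all large $i$. Put $m_i(S)=|S^{i-1}/S'^i|+|S^i/S'^i|$, length $n=\sum_i m_i(S)$, $x^S=\prod_ix_i^{m_i(S)}$. $\mathrm{ss}_{\lambda,n}(x)=\sum x^S$ over SSOTs of shape $\lambda$ and length $n$, and $\mathrm{ss}_{\lambda,n}(x_1,\dots,x_k)$ is its specialization at $x_{k+1}=x_{k+2}=\dots=0$.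
   Formalization: Membership of a lattice point in New(f) is expressed through convex combinations of points of supp f with nonnegative rational weights in place of real ones. -}

module Defs where

open import Data.Nat as ℕ using (ℕ; zero; suc; _+_; _∸_; _≤_; _<_; _%_)
open import Data.List using (List; []; _∷_; map)
import Data.List as L
open import Data.Fin using (Fin; toℕ)
open import Data.Product using (Σ; ∃; _×_; proj₁; proj₂)
open import Data.List.Relation.Unary.All using (All)
import Data.Nat.ListAction as NL
open import Data.Integer using (+_)
open import Data.Rational as ℚ using (ℚ; 0ℚ; 1ℚ)
open import Relation.Binary.PropositionalEquality using (_≡_)

-- j-th part (0-indexed), zero beyond the length
part : List ℕ → ℕ → ℕ
part []       _       = 0
part (p ∷ ps) zero    = p
part (p ∷ ps) (suc j) = part ps j

IsPartition : List ℕ → Set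
IsPartition μ = (∀ j → part μ (suc j) ≤ part μ j) × (∀ j → j < L.length μ → 1 ≤ part μ j)

size : List ℕ → ℕ
size = NL.sum

_⊆ₚ_ : List ℕ → List ℕ → Set
μ ⊆ₚ λ' = ∀ j → part μ j ≤ part λ' j

-- λ/μ is a (defined) skew shape which is a horizontal strip:
-- μ ⊆ λ and at most one box in each column, i.e. λ_{j+1} ≤ μ_j.
HorizontalStrip : List ℕ → List ℕ → Set
HorizontalStrip λ' μ = μ ⊆ₚ λ' × (∀ j → part λ' (suc j) ≤ part μ j)

InN : List ℕ → ℕ → Set
InN λ' n = size λ' ≤ n × n % 2 ≡ size λ' % 2

-- Semistandard oscillating tableaux.
-- S i  stands for S^i  (i ≥ 0, with S^0 = ∅),
-- S' i stands for S'^i (i ≥ 1, with S'^1 = ∅; S' 0 is unused).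

record SSOT (λ' : List ℕ) : Set where
  field
    S       : ℕ → List ℕ
    S'      : ℕ → List ℕ
    S-part  : ∀ i → IsPartition (S i)
    S'-part : ∀ i → IsPartition (S' (suc i))
    S0      : S 0 ≡ []
    S'1     : S' 1 ≡ []
    -- for i ≥ 1:  S^{i-1}/S'^i and S^i/S'^i are horizontal strips
    strip₁  : ∀ i → HorizontalStrip (S i) (S' (suc i))
    strip₂  : ∀ i → HorizontalStrip (S (suc i)) (S' (suc i))
    stable  : ∃ λ N → ∀ i → N ≤ i → (S i ≡ λ') × (S' (suc i) ≡ λ')

-- m_i(S) for i ≥ 1 (m 0 is unused and set to 0)
m : ∀ {λ'} → SSOT λ' → ℕ → ℕ
m T zero    = 0
m T (suc i) = (size (S i) ∸ size (S' (suc i))) + (size (S (suc i)) ∸ size (S' (suc i)))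
  where open SSOT T

-- All coefficients of ss_{λ,n} are nonnegative counts, so after setting
-- x_{k+1} = x_{k+2} = … = 0, the exponent a ∈ ℕ^k lies in the support iff
-- some SSOT S of shape λ and length n has m_i(S) = a_i (i ≤ k) and
-- m_i(S) = 0 (i > k).

sumFin : ∀ k → (Fin k → ℕ) → ℕ
sumFin k a = NL.sum (map a (L.allFin k))

InSupp : List ℕ → ℕ → (k : ℕ) → (Fin k → ℕ) → Set
InSupp λ' n k a =
  Σ (SSOT λ') λ T →
    (∀ (i : Fin k) → m T (suc (toℕ i)) ≡ a i)
    × (∀ i → k < i → m T i ≡ 0)
    × sumFin k a ≡ n     -- length of S, = Σ_i m_i(S)

toℚ : ℕ → ℚ
toℚ n = (+ n) ℚ./ 1

sumℚ : List ℚ → ℚ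
sumℚ = L.foldr ℚ._+_ 0ℚ

InConvexHull : (k : ℕ) → ((Fin k → ℕ) → Set) → (Fin k → ℕ) → Set
InConvexHull k P a =
  Σ (List (ℚ × (Fin k → ℕ))) λ ws →
    All (λ wp → (0ℚ ℚ.≤ proj₁ wp) × P (proj₂ wp)) ws
    × sumℚ (map proj₁ ws) ≡ 1ℚ
    × (∀ (j : Fin k) →
         sumℚ (map (λ wp → proj₁ wp ℚ.* toℚ (proj₂ wp j)) ws) ≡ toℚ (a j))

-- Write n = |λ| + 2t. An exponent vector a ∈ ℕ^k lies in the support of ss_{λ,n}(x_1,…,x_k) iff
-- Σ a = n and every set J of j variables satisfies Σ_J a ≤ λ_1 + … + λ_j + min(j,2)·t.
-- Necessity holds step by step along an SSOT: a step removes a horizontal strip of r boxes and adds one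
-- of s boxes, and the inequalities for the old shape and t imply those for the new shape and t + r.
-- Sufficiency is proved by peeling off the last variable: remove from λ a horizontal strip lying as low as
-- possible and add the remaining boxes to the first row, in amounts chosen so that the inequalities survive.
-- Being cut out by linear inequalities, the support contains every lattice point of its convex hull.

module Submission where

open import Defs
open import Algebra.Bundles using (CommutativeMonoid)
open import Data.Bool using (Bool; true; false; if_then_else_)
open import Data.Fin as Fin using (Fin; toℕ; fromℕ<)
open import Data.Fin.Properties using (toℕ<n; toℕ-fromℕ<; fromℕ<-toℕ)
import Data.Integer as ℤ
import Data.Integer.Properties as ℤ
open import Data.List using (List; []; _∷_; length; take; drop; map; allFin)
open import Data.List.Properties using (take++drop≡id; take-all; map-tabulate; map-cong)
open import Data.List.Relation.Unary.All as All using (All; []; _∷_)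
open import Data.Nat using (ℕ; zero; suc; _+_; _∸_; _*_; _≤_; _<_; _⊔_; _≡ᵇ_; _≤?_; _<?_; z≤n; s≤s)
import Data.Nat.Coprimality as Coprime
import Data.Nat.ListAction as NL
open import Data.Nat.ListAction.Properties using (sum-++)
open import Data.Nat.Properties
open import Data.Nat.Tactic.RingSolver using (solve-∀)
open import Data.Product using (Σ; _×_; _,_; proj₁; proj₂)
open import Data.Rational as ℚ using (ℚ; 0ℚ; 1ℚ)
import Data.Rational.Properties as ℚ
import Data.Rational.Unnormalised as ℚᵘ
import Data.Rational.Unnormalised.Properties as ℚᵘ
open import Data.Sum using (_⊎_; inj₁; inj₂)
open import Data.Unit using (tt)
open import Function using (_∘_)
open import Relation.Binary using (tri<; tri≈; tri>)
open import Relation.Binary.PropositionalEquality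
open import Relation.Nullary using (yes; no; contradiction)
import Algebra.Properties.CommutativeSemigroup as CommutativeSemigroupProperties

open CommutativeSemigroupProperties +-commutativeSemigroup using (x∙yz≈y∙xz; xy∙z≈x∙zy; xy∙z≈xz∙y)
module ℚ+ = CommutativeSemigroupProperties (CommutativeMonoid.commutativeSemigroup ℚ.+-0-commutativeMonoid)

sumTo : ℕ → (ℕ → ℕ) → ℕ
sumTo zero    f = 0
sumTo (suc k) f = sumTo k f + f k

sumTo-cong : ∀ k {f g : ℕ → ℕ} → (∀ i → i < k → f i ≡ g i) → sumTo k f ≡ sumTo k g
sumTo-cong zero    f≡g = refl
sumTo-cong (suc k) f≡g = cong₂ _+_ (sumTo-cong k (λ i i<k → f≡g i (m≤n⇒m≤1+n i<k))) (f≡g k ≤-refl)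

sumTo-mono : ∀ k {f g : ℕ → ℕ} → (∀ i → i < k → f i ≤ g i) → sumTo k f ≤ sumTo k g
sumTo-mono zero    f≤g = z≤n
sumTo-mono (suc k) f≤g = +-mono-≤ (sumTo-mono k (λ i i<k → f≤g i (m≤n⇒m≤1+n i<k))) (f≤g k ≤-refl)

sumTo-suc : ∀ k (f : ℕ → ℕ) → sumTo (suc k) f ≡ f 0 + sumTo k (f ∘ suc)
sumTo-suc zero    f = +-comm 0 (f 0)
sumTo-suc (suc k) f = trans (cong (_+ f (suc k)) (sumTo-suc k f)) (+-assoc (f 0) _ _)

topSize : ℕ → List ℕ → ℕ
topSize j μ = size (take j μ)

topSize-one : ∀ μ → topSize 1 μ ≡ part μ 0
topSize-one []      = refl
topSize-one (p ∷ _) = +-identityʳ p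

topSize-suc : ∀ j μ → topSize (suc j) μ ≡ topSize j μ + part μ j
topSize-suc zero    μ        = topSize-one μ
topSize-suc (suc j) []       = refl
topSize-suc (suc j) (p ∷ ps) = trans (cong (p +_) (topSize-suc j ps)) (sym (+-assoc p _ _))

topSize-all : ∀ j μ → length μ ≤ j → topSize j μ ≡ size μ
topSize-all j μ len≤j = cong size (take-all j μ len≤j)

size≡topSize+size-drop : ∀ j μ → size μ ≡ topSize j μ + size (drop j μ)
size≡topSize+size-drop j μ = trans (cong size (sym (take++drop≡id j μ))) (sum-++ (take j μ) (drop j μ))

topSize≤size : ∀ j μ → topSize j μ ≤ size μ
topSize≤size j μ = subst (topSize j μ ≤_) (sym (size≡topSize+size-drop j μ)) (m≤m+n _ _)

part-drop : ∀ j μ r → part (drop j μ) r ≡ part μ (j + r)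
part-drop zero    μ        r = refl
part-drop (suc j) []       r = refl
part-drop (suc j) (p ∷ ps) r = part-drop j ps r

size-mono : ∀ ν μ → ν ⊆ₚ μ → size ν ≤ size μ
size-mono []       μ        ν⊆μ = z≤n
size-mono (q ∷ qs) []       ν⊆μ = +-mono-≤ (ν⊆μ 0) (size-mono qs [] (ν⊆μ ∘ suc))
size-mono (q ∷ qs) (p ∷ ps) ν⊆μ = +-mono-≤ (ν⊆μ 0) (size-mono qs ps (ν⊆μ ∘ suc))

topSize-mono : ∀ j ν μ → ν ⊆ₚ μ → topSize j ν ≤ topSize j μ
topSize-mono zero    ν        μ        ν⊆μ = z≤n
topSize-mono (suc j) []       μ        ν⊆μ = z≤n
topSize-mono (suc j) (q ∷ qs) []       ν⊆μ = ≤-trans (topSize≤size (suc j) (q ∷ qs)) (size-mono (q ∷ qs) [] ν⊆μ)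
topSize-mono (suc j) (q ∷ qs) (p ∷ ps) ν⊆μ = +-mono-≤ (ν⊆μ 0) (topSize-mono j qs ps (ν⊆μ ∘ suc))

drop-⊆ : ∀ j ν μ → ν ⊆ₚ μ → drop j ν ⊆ₚ drop j μ
drop-⊆ j ν μ ν⊆μ r = subst₂ _≤_ (sym (part-drop j ν r)) (sym (part-drop j μ r)) (ν⊆μ (j + r))

strip-drop : ∀ j λ' ν → HorizontalStrip λ' ν → drop (suc j) λ' ⊆ₚ drop j ν
strip-drop j λ' ν (_ , shifted) r =
  subst₂ _≤_ (sym (part-drop (suc j) λ' r)) (sym (part-drop j ν r)) (shifted (j + r))

topSize-grow : ∀ j ν μ {r} → ν ⊆ₚ μ → size μ ≡ size ν + r → topSize j μ ≤ topSize j ν + r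
topSize-grow j ν μ {r} ν⊆μ |μ|≡|ν|+r = +-cancelʳ-≤ (size (drop j ν)) _ _ (begin
  topSize j μ + size (drop j ν)         ≤⟨ +-monoʳ-≤ (topSize j μ) below ⟩
  topSize j μ + size (drop j μ)         ≡⟨ sym (size≡topSize+size-drop j μ) ⟩
  size μ                                ≡⟨ |μ|≡|ν|+r ⟩
  size ν + r                            ≡⟨ cong (_+ r) (size≡topSize+size-drop j ν) ⟩
  topSize j ν + size (drop j ν) + r     ≡⟨ xy∙z≈xz∙y (topSize j ν) _ r ⟩
  topSize j ν + r + size (drop j ν)     ∎)
  where
  open ≤-Reasoning
  below : size (drop j ν) ≤ size (drop j μ)
  below = size-mono (drop j ν) (drop j μ) (drop-⊆ j ν μ ν⊆μ)

-- Row r+1 of λ is no longer than row r of ν, so the rows of λ below j+1 fit inside those of ν below j.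
topSize-strip : ∀ j λ' ν {s} → HorizontalStrip λ' ν → size λ' ≡ size ν + s →
                topSize j ν + s ≤ topSize (suc j) λ'
topSize-strip j λ' ν {s} strip |λ|≡|ν|+s = +-cancelʳ-≤ (size (drop j ν)) _ _ (begin
  topSize j ν + s + size (drop j ν)          ≡⟨ xy∙z≈xz∙y (topSize j ν) s _ ⟩
  topSize j ν + size (drop j ν) + s          ≡⟨ cong (_+ s) (sym (size≡topSize+size-drop j ν)) ⟩
  size ν + s                                 ≡⟨ sym |λ|≡|ν|+s ⟩
  size λ'                                    ≡⟨ size≡topSize+size-drop (suc j) λ' ⟩
  topSize (suc j) λ' + size (drop (suc j) λ') ≤⟨ +-monoʳ-≤ (topSize (suc j) λ') below ⟩
  topSize (suc j) λ' + size (drop j ν)       ∎)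
  where
  open ≤-Reasoning
  below : size (drop (suc j) λ') ≤ size (drop j ν)
  below = size-mono (drop (suc j) λ') (drop j ν) (strip-drop j λ' ν strip)

-- The support inequalities

select : (ℕ → Bool) → (ℕ → ℕ) → ℕ → ℕ
select J a i = if J i then a i else 0

count : ℕ → (ℕ → Bool) → ℕ
count k J = sumTo k (select J (λ _ → 1))

bound : List ℕ → ℕ → ℕ → ℕ
bound λ' t zero          = 0
bound λ' t (suc zero)    = topSize 1 λ' + t
bound λ' t (suc (suc j)) = topSize (suc (suc j)) λ' + (t + t)

bound-suc≤ : ∀ λ' t j → bound λ' t (suc j) ≤ topSize (suc j) λ' + (t + t)
bound-suc≤ λ' t zero    = +-monoʳ-≤ (topSize 1 λ') (m≤m+n t t)
bound-suc≤ λ' t (suc j) = ≤-refl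

-- The inequalities cutting out supp ss_{λ,|λ|+2t}(x_1,…,x_k); a i is the exponent of x_{i+1}.
record Admissible (λ' : List ℕ) (t k : ℕ) (a : ℕ → ℕ) : Set where
  field
    total  : sumTo k a ≡ size λ' + (t + t)
    subset : ∀ J → sumTo k (select J a) ≤ bound λ' t (count k J)

module _ {μ ν λ' : List ℕ} {t r s : ℕ} (ν⊆μ : ν ⊆ₚ μ) (λ/ν : HorizontalStrip λ' ν)
         (|μ| : size μ ≡ size ν + r) (|λ| : size λ' ≡ size ν + s) where
  private
    open ≤-Reasoning

    grow : ∀ j → topSize j μ ≤ topSize j λ' + r
    grow j = ≤-trans (topSize-grow j ν μ ν⊆μ |μ|) (+-monoˡ-≤ r (topSize-mono j ν λ' (proj₁ λ/ν)))

  bound-step : ∀ j σ → σ ≤ bound μ t j → σ ≤ bound λ' (t + r) j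
  bound-step zero          σ σ≤ = σ≤
  bound-step (suc zero)    σ σ≤ = begin
    σ                                         ≤⟨ σ≤ ⟩
    topSize 1 μ + t                           ≤⟨ +-monoˡ-≤ t (grow 1) ⟩
    topSize 1 λ' + r + t                      ≡⟨ xy∙z≈x∙zy (topSize 1 λ') r t ⟩
    topSize 1 λ' + (t + r)                    ∎
  bound-step (suc (suc j)) σ σ≤ = begin
    σ                                         ≤⟨ σ≤ ⟩
    topSize (2 + j) μ + (t + t)               ≤⟨ +-monoˡ-≤ (t + t) (grow (2 + j)) ⟩
    topSize (2 + j) λ' + r + (t + t)          ≤⟨ +-monoʳ-≤ (topSize (2 + j) λ' + r) (m≤n+m (t + t) r) ⟩
    topSize (2 + j) λ' + r + (r + (t + t))    ≡⟨ shuffle (topSize (2 + j) λ') r t ⟩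
    topSize (2 + j) λ' + ((t + r) + (t + r))  ∎
    where
    shuffle : ∀ x r t → x + r + (r + (t + t)) ≡ x + ((t + r) + (t + r))
    shuffle = solve-∀

  bound-step-+ : ∀ j σ → σ ≤ bound μ t j → σ + (r + s) ≤ bound λ' (t + r) (suc j)
  bound-step-+ zero    σ σ≤ rewrite n≤0⇒n≡0 σ≤ = begin
    r + s                    ≡⟨ +-comm r s ⟩
    s + r                    ≤⟨ +-mono-≤ (topSize-strip 0 λ' ν λ/ν |λ|) (m≤n+m r t) ⟩
    topSize 1 λ' + (t + r)   ∎
  bound-step-+ (suc j) σ σ≤ = begin
    σ + (r + s)                                 ≤⟨ +-monoˡ-≤ (r + s) σ≤′ ⟩
    topSize (suc j) ν + r + (t + t) + (r + s)   ≡⟨ shuffle (topSize (suc j) ν) r s t ⟩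
    topSize (suc j) ν + s + ((t + r) + (t + r)) ≤⟨ +-monoˡ-≤ ((t + r) + (t + r)) (topSize-strip (suc j) λ' ν λ/ν |λ|) ⟩
    topSize (2 + j) λ' + ((t + r) + (t + r))    ∎
    where
    σ≤′ : σ ≤ topSize (suc j) ν + r + (t + t)
    σ≤′ = ≤-trans σ≤ (≤-trans (bound-suc≤ μ t j) (+-monoˡ-≤ (t + t) (topSize-grow (suc j) ν μ ν⊆μ |μ|)))
    shuffle : ∀ x r s t → x + r + (t + t) + (r + s) ≡ x + s + ((t + r) + (t + r))
    shuffle = solve-∀

  admissible-step : ∀ {k} {a : ℕ → ℕ} → a k ≡ r + s → Admissible μ t k a → Admissible λ' (t + r) (suc k) a
  admissible-step {k} {a} ak≡r+s adm = record { total = total′ ; subset = subset′ }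
    where
    open Admissible adm

    total′ : sumTo k a + a k ≡ size λ' + ((t + r) + (t + r))
    total′ = begin-equality
      sumTo k a + a k                        ≡⟨ cong₂ _+_ total ak≡r+s ⟩
      size μ + (t + t) + (r + s)             ≡⟨ cong (λ m → m + (t + t) + (r + s)) |μ| ⟩
      size ν + r + (t + t) + (r + s)         ≡⟨ shuffle (size ν) r s t ⟩
      size ν + s + ((t + r) + (t + r))       ≡⟨ cong (_+ ((t + r) + (t + r))) (sym |λ|) ⟩
      size λ' + ((t + r) + (t + r))          ∎
      where
      shuffle : ∀ x r s t → x + r + (t + t) + (r + s) ≡ x + s + ((t + r) + (t + r))
      shuffle = solve-∀

    subset′ : ∀ J → sumTo (suc k) (select J a) ≤ bound λ' (t + r) (count (suc k) J)
    subset′ J with J k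
    ... | false = subst₂ _≤_ (sym (+-identityʳ σ)) (cong (bound λ' (t + r)) (sym (+-identityʳ (count k J))))
                    (bound-step (count k J) σ (subset J))
      where
      σ : ℕ
      σ = sumTo k (select J a)
    ... | true  = subst₂ _≤_ (cong (σ +_) (sym ak≡r+s)) (cong (bound λ' (t + r)) (+-comm 1 (count k J)))
                    (bound-step-+ (count k J) σ (subset J))
      where
      σ : ℕ
      σ = sumTo k (select J a)

size-cong : ∀ μ λ' → (∀ j → topSize j μ ≡ topSize j λ') → size μ ≡ size λ'
size-cong μ λ' same = begin
  size μ        ≡⟨ sym (topSize-all N μ (m≤m+n (length μ) (length λ'))) ⟩
  topSize N μ   ≡⟨ same N ⟩
  topSize N λ'  ≡⟨ topSize-all N λ' (m≤n+m (length λ') (length μ)) ⟩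
  size λ'       ∎
  where
  open ≡-Reasoning
  N : ℕ
  N = length μ + length λ'

bound-cong : ∀ μ λ' t j → (∀ j → topSize j μ ≡ topSize j λ') → bound μ t j ≡ bound λ' t j
bound-cong μ λ' t zero          same = refl
bound-cong μ λ' t (suc zero)    same = cong (_+ t) (same 1)
bound-cong μ λ' t (suc (suc j)) same = cong (_+ (t + t)) (same (suc (suc j)))

admissible-cong : ∀ {μ λ' t k a} → (∀ j → topSize j μ ≡ topSize j λ') →
                  Admissible μ t k a → Admissible λ' t k a
admissible-cong {μ} {λ'} {t} {k} same adm = record
  { total  = trans total (cong (_+ (t + t)) (size-cong μ λ' same))
  ; subset = λ J → subst (sumTo k _ ≤_) (bound-cong μ λ' t (count k J) same) (subset J)
  }
  where open Admissible adm

admissible-congᵃ : ∀ {λ' t k} {a b : ℕ → ℕ} → (∀ i → i < k → a i ≡ b i) →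
                   Admissible λ' t k a → Admissible λ' t k b
admissible-congᵃ {λ'} {t} {k} {a} {b} a≡b adm = record
  { total  = trans (sym (sumTo-cong k a≡b)) total
  ; subset = λ J → subst (_≤ bound λ' t (count k J)) (sumTo-cong k (select-cong J)) (subset J)
  }
  where
  open Admissible adm
  select-cong : ∀ J i → i < k → select J a i ≡ select J b i
  select-cong J i i<k = cong (λ x → if J i then x else 0) (a≡b i i<k)

topSize-≡ : ∀ j ν μ → ν ⊆ₚ μ → size μ ≤ size ν → topSize j μ ≡ topSize j ν
topSize-≡ j ν μ ν⊆μ |μ|≤|ν| = ≤-antisym
  (subst (topSize j μ ≤_) (+-identityʳ (topSize j ν))
     (topSize-grow j ν μ ν⊆μ (trans (≤-antisym |μ|≤|ν| (size-mono ν μ ν⊆μ)) (sym (+-identityʳ (size ν))))))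
  (topSize-mono j ν μ ν⊆μ)

-- Necessity

module _ {λ'} (T : SSOT λ') where
  open SSOT T

  ssot-admissible : ∀ i → Σ ℕ λ t → Admissible (S i) t i (λ j → m T (suc j))
  ssot-admissible zero    = 0 , record { total = cong (λ μ → size μ + 0) (sym S0) ; subset = λ _ → z≤n }
  ssot-admissible (suc i) with ssot-admissible i
  ... | t , adm = t + (size (S i) ∸ size ν) ,
    admissible-step {S i} {ν} {S (suc i)} (proj₁ (strip₁ i)) (strip₂ i)
                    (grows (S i) (strip₁ i)) (grows (S (suc i)) (strip₂ i)) refl adm
    where
    ν : List ℕ
    ν = S' (suc i)
    grows : ∀ μ → HorizontalStrip μ ν → size μ ≡ size ν + (size μ ∸ size ν)
    grows μ (ν⊆μ , _) = sym (m+[n∸m]≡n (size-mono ν μ ν⊆μ))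

  idle-step : ∀ i → m T (suc i) ≡ 0 → ∀ j → topSize j (S (suc i)) ≡ topSize j (S i)
  idle-step i m≡0 j = trans (topSize-≡ j ν (S (suc i)) (proj₁ (strip₂ i)) (m∸n≡0⇒m≤n (m+n≡0⇒n≡0 _ m≡0)))
                            (sym (topSize-≡ j ν (S i) (proj₁ (strip₁ i)) (m∸n≡0⇒m≤n (m+n≡0⇒m≡0 _ m≡0))))
    where
    ν : List ℕ
    ν = S' (suc i)

  idle-tail : ∀ k → (∀ i → k < i → m T i ≡ 0) → ∀ j → topSize j (S k) ≡ topSize j λ'
  idle-tail k idle j = trans (sym (idle-run N)) (cong (topSize j) (proj₁ (proj₂ stable (k + N) (m≤n+m N k))))
    where
    N : ℕ
    N = proj₁ stable
    idle-run : ∀ d → topSize j (S (k + d)) ≡ topSize j (S k)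
    idle-run zero    = cong (λ i → topSize j (S i)) (+-identityʳ k)
    idle-run (suc d) = begin
      topSize j (S (k + suc d))  ≡⟨ cong (λ i → topSize j (S i)) (+-suc k d) ⟩
      topSize j (S (suc (k + d))) ≡⟨ idle-step (k + d) (idle (suc (k + d)) (s≤s (m≤m+n k d))) j ⟩
      topSize j (S (k + d))      ≡⟨ idle-run d ⟩
      topSize j (S k)            ∎
      where open ≡-Reasoning

extend : ∀ k → (Fin k → ℕ) → ℕ → ℕ
extend k a i with i <? k
... | yes i<k = a (fromℕ< i<k)
... | no  _   = 0

extend-fromℕ< : ∀ k a {i} (i<k : i < k) → extend k a i ≡ a (fromℕ< i<k)
extend-fromℕ< k a {i} i<k with i <? k
... | yes _   = refl
... | no  i≮k = contradiction i<k i≮k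

extend-toℕ : ∀ k a (j : Fin k) → extend k a (toℕ j) ≡ a j
extend-toℕ k a j = trans (extend-fromℕ< k a (toℕ<n j)) (cong a (fromℕ<-toℕ j (toℕ<n j)))

sumFin-suc : ∀ k (h : Fin (suc k) → ℕ) → sumFin (suc k) h ≡ h Fin.zero + sumFin k (h ∘ Fin.suc)
sumFin-suc k h = cong (λ xs → h Fin.zero + NL.sum xs)
  (trans (map-tabulate Fin.suc h) (sym (map-tabulate (λ j → j) (h ∘ Fin.suc))))

sumTo-sumFin : ∀ k (f : ℕ → ℕ) → sumTo k f ≡ sumFin k (f ∘ toℕ)
sumTo-sumFin zero    f = refl
sumTo-sumFin (suc k) f = begin
  sumTo (suc k) f                  ≡⟨ sumTo-suc k f ⟩
  f 0 + sumTo k (f ∘ suc)          ≡⟨ cong (f 0 +_) (sumTo-sumFin k (f ∘ suc)) ⟩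
  f 0 + sumFin k (f ∘ suc ∘ toℕ)   ≡⟨ sym (sumFin-suc k (f ∘ toℕ)) ⟩
  sumFin (suc k) (f ∘ toℕ)         ∎
  where open ≡-Reasoning

subsetSum : ∀ k → (ℕ → Bool) → (Fin k → ℕ) → ℕ
subsetSum k J v = sumFin k (λ j → if J (toℕ j) then v j else 0)

sumTo-select-extend : ∀ k J v → sumTo k (select J (extend k v)) ≡ subsetSum k J v
sumTo-select-extend k J v = trans (sumTo-sumFin k _)
  (cong NL.sum (map-cong (λ j → cong (if J (toℕ j) then_else 0) (extend-toℕ k v j)) (allFin k)))

sumTo-extend : ∀ k a → sumTo k (extend k a) ≡ sumFin k a
sumTo-extend k a = sumTo-select-extend k (λ _ → true) a

support⇒admissible : ∀ {λ' n k a} → InSupp λ' n k a →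
                     Σ ℕ λ t → n ≡ size λ' + (t + t) × Admissible λ' t k (extend k a)
support⇒admissible {λ'} {n} {k} {a} (T , m≡a , idle , Σa≡n) = t , n≡ , adm
  where
  t : ℕ
  t = proj₁ (ssot-admissible T k)
  m≡extend : ∀ i → i < k → m T (suc i) ≡ extend k a i
  m≡extend i i<k = begin
    m T (suc i)                   ≡⟨ cong (m T ∘ suc) (sym (toℕ-fromℕ< i<k)) ⟩
    m T (suc (toℕ (fromℕ< i<k)))  ≡⟨ m≡a (fromℕ< i<k) ⟩
    a (fromℕ< i<k)                ≡⟨ sym (extend-fromℕ< k a i<k) ⟩
    extend k a i                  ∎
    where open ≡-Reasoning
  adm : Admissible λ' t k (extend k a)
  adm = admissible-congᵃ m≡extend (admissible-cong (idle-tail T k idle) (proj₂ (ssot-admissible T k)))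
  n≡ : n ≡ size λ' + (t + t)
  n≡ = trans (sym Σa≡n) (trans (sym (sumTo-extend k a)) (Admissible.total adm))

double-injective : ∀ {t u} → t + t ≡ u + u → t ≡ u
double-injective {t} {u} t+t≡u+u with <-cmp t u
... | tri< t<u _ _ = contradiction t+t≡u+u (<⇒≢ (+-mono-< t<u t<u))
... | tri≈ _ t≡u _ = t≡u
... | tri> _ _ u<t = contradiction (sym t+t≡u+u) (<⇒≢ (+-mono-< u<t u<t))

support⇒admissible-at : ∀ {λ' n k a} t → n ≡ size λ' + (t + t) → InSupp λ' n k a →
                        Admissible λ' t k (extend k a)
support⇒admissible-at {λ'} {k = k} {a} t n≡ a∈supp with support⇒admissible a∈supp
... | u , n≡′ , adm = subst (λ u → Admissible λ' u k (extend k a)) u≡t adm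
  where
  u≡t : u ≡ t
  u≡t = double-injective (+-cancelˡ-≡ (size λ') _ _ (trans (sym n≡′) n≡))

[]-partition : IsPartition []
[]-partition = (λ _ → z≤n) , (λ _ ())

∷-partition : ∀ {p ps} → 1 ≤ p → part ps 0 ≤ p → IsPartition ps → IsPartition (p ∷ ps)
∷-partition {p} {ps} 1≤p ps₀≤p (decreasing , positive) = decreasing′ , positive′
  where
  decreasing′ : ∀ j → part (p ∷ ps) (suc j) ≤ part (p ∷ ps) j
  decreasing′ zero    = ps₀≤p
  decreasing′ (suc j) = decreasing j
  positive′ : ∀ j → j < suc (length ps) → 1 ≤ part (p ∷ ps) j
  positive′ zero    _         = 1≤p
  positive′ (suc j) (s≤s j<n) = positive j j<n

tail-partition : ∀ {p ps} → IsPartition (p ∷ ps) → IsPartition ps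
tail-partition (decreasing , positive) = decreasing ∘ suc , λ j j<n → positive (suc j) (s≤s j<n)

head-positive : ∀ {p ps} → IsPartition (p ∷ ps) → 1 ≤ p
head-positive (_ , positive) = positive 0 (s≤s z≤n)

part-antitone : ∀ {μ} → IsPartition μ → ∀ {i j} → i ≤ j → part μ j ≤ part μ i
part-antitone {μ} (decreasing , _) {i} i≤j with m≤n⇒∃[o]m+o≡n i≤j
... | d , refl = go d
  where
  go : ∀ d → part μ (i + d) ≤ part μ i
  go zero    = ≤-reflexive (cong (part μ) (+-identityʳ i))
  go (suc d) = ≤-trans (≤-reflexive (cong (part μ) (+-suc i d))) (≤-trans (decreasing (i + d)) (go d))

size≡0⇒≡[] : ∀ {μ} → IsPartition μ → size μ ≡ 0 → μ ≡ []
size≡0⇒≡[] {[]}    _       _       = refl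
size≡0⇒≡[] {p ∷ _} μ-part |μ|≡0 = contradiction (m+n≡0⇒m≡0 p |μ|≡0) (>⇒≢ (head-positive μ-part))

strip-refl : ∀ {μ} → IsPartition μ → HorizontalStrip μ μ
strip-refl (decreasing , _) = (λ _ → ≤-refl) , decreasing

topSize-[] : ∀ j → topSize j [] ≡ 0
topSize-[] zero    = refl
topSize-[] (suc j) = refl

oneRow : ℕ → List ℕ
oneRow zero    = []
oneRow (suc x) = suc x ∷ []

oneRow-partition : ∀ x → IsPartition (oneRow x)
oneRow-partition zero    = []-partition
oneRow-partition (suc x) = ∷-partition (s≤s z≤n) z≤n []-partition

part-oneRow : ∀ x j → part (oneRow x) j ≡ part (x ∷ []) j
part-oneRow zero    zero    = refl
part-oneRow zero    (suc j) = refl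
part-oneRow (suc x) j       = refl

size-oneRow : ∀ x → size (oneRow x) ≡ x
size-oneRow zero    = refl
size-oneRow (suc x) = +-identityʳ (suc x)

topSize-oneRow : ∀ j x → topSize (suc j) (oneRow x) ≡ x
topSize-oneRow j zero    = refl
topSize-oneRow j (suc x) = trans (cong (suc x +_) (topSize-[] j)) (+-identityʳ (suc x))

-- Remove from p ∷ ps a horizontal strip of s ≤ p boxes lying as low as possible.
removeStrip∷ : ℕ → ℕ → List ℕ → List ℕ
removeStrip∷ s p []       = oneRow (p ∸ s)
removeStrip∷ s p (q ∷ qs) with s ≤? q
... | yes _ = p ∷ removeStrip∷ s q qs
... | no  _ = p ∸ (s ∸ q) ∷ qs

removeStrip : List ℕ → ℕ → List ℕ
removeStrip []       s = []
removeStrip (p ∷ ps) s = removeStrip∷ s p ps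

-- Either the strip avoids the top j rows, or the rows j+1, j+2, … of ν are the rows j+2, j+3, … of λ.
LowAt : List ℕ → ℕ → List ℕ → ℕ → Set
LowAt λ' s ν j = topSize j ν ≡ topSize j λ' ⊎ topSize j ν + s ≡ topSize (suc j) λ'

record StripRemoval (λ' : List ℕ) (s : ℕ) (ν : List ℕ) : Set where
  field
    partition : IsPartition ν
    strip     : HorizontalStrip λ' ν
    size≡     : size λ' ≡ size ν + s
    low       : ∀ j → LowAt λ' s ν j

oneRow-removal : ∀ s p → s ≤ p → StripRemoval (p ∷ []) s (oneRow (p ∸ s))
oneRow-removal s p s≤p = record
  { partition = oneRow-partition (p ∸ s)
  ; strip     = (λ j → subst (_≤ part (p ∷ []) j) (sym (part-oneRow (p ∸ s) j)) (below j)) , (λ _ → z≤n)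
  ; size≡     = sym (trans (cong (_+ s) (size-oneRow (p ∸ s))) p∸s+s≡p)
  ; low       = low
  }
  where
  p∸s+s≡p : p ∸ s + s ≡ p + 0
  p∸s+s≡p = trans (m∸n+n≡m s≤p) (sym (+-identityʳ p))
  below : ∀ j → part (p ∸ s ∷ []) j ≤ part (p ∷ []) j
  below zero    = m∸n≤m p s
  below (suc j) = z≤n
  low : ∀ j → LowAt (p ∷ []) s (oneRow (p ∸ s)) j
  low zero    = inj₁ refl
  low (suc j) = inj₂ (trans (cong (_+ s) (topSize-oneRow j (p ∸ s))) p∸s+s≡p)

keep-first-row : ∀ {s p q qs ν} → IsPartition (p ∷ q ∷ qs) → StripRemoval (q ∷ qs) s ν →
                 StripRemoval (p ∷ q ∷ qs) s (p ∷ ν)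
keep-first-row {s} {p} {q} {qs} {ν} λ-part removal = record
  { partition = ∷-partition (head-positive λ-part) (≤-trans (proj₁ R.strip 0) q≤p) R.partition
  ; strip     = below , shifted
  ; size≡     = trans (cong (p +_) R.size≡) (sym (+-assoc p _ s))
  ; low       = low
  }
  where
  module R = StripRemoval removal
  q≤p : q ≤ p
  q≤p = proj₁ λ-part 0
  below : ∀ j → part (p ∷ ν) j ≤ part (p ∷ q ∷ qs) j
  below zero    = ≤-refl
  below (suc j) = proj₁ R.strip j
  shifted : ∀ j → part (p ∷ q ∷ qs) (suc j) ≤ part (p ∷ ν) j
  shifted zero    = q≤p
  shifted (suc j) = proj₂ R.strip j
  low : ∀ j → LowAt (p ∷ q ∷ qs) s (p ∷ ν) j
  low zero    = inj₁ refl
  low (suc j) with R.low j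
  ... | inj₁ same    = inj₁ (cong (p +_) same)
  ... | inj₂ shifted = inj₂ (trans (+-assoc p _ s) (cong (p +_) shifted))

-- When the rows below the first cannot absorb the s boxes, all of them move up one row.
shift-rows-up : ∀ {s p q qs} → IsPartition (p ∷ q ∷ qs) → q < s → s ≤ p →
                StripRemoval (p ∷ q ∷ qs) s (p ∸ (s ∸ q) ∷ qs)
shift-rows-up {s} {p} {q} {qs} λ-part q<s s≤p = record
  { partition = ∷-partition (≤-trans (head-positive qs-part) q≤p∸d) (≤-trans (proj₁ λ-part 1) q≤p∸d)
                            (tail-partition qs-part)
  ; strip     = below , shifted
  ; size≡     = sym (regroup (size qs))
  ; low       = low
  }
  where
  d : ℕ
  d = s ∸ q
  qs-part : IsPartition (q ∷ qs)
  qs-part = tail-partition λ-part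
  q+d≡s : q + d ≡ s
  q+d≡s = m+[n∸m]≡n (<⇒≤ q<s)
  p∸d+d≡p : p ∸ d + d ≡ p
  p∸d+d≡p = m∸n+n≡m (≤-trans (m∸n≤m s q) s≤p)
  q≤p∸d : q ≤ p ∸ d
  q≤p∸d = +-cancelʳ-≤ d q (p ∸ d) (subst₂ _≤_ (sym q+d≡s) (sym p∸d+d≡p) s≤p)
  regroup : ∀ X → p ∸ d + X + s ≡ p + (q + X)
  regroup X = begin
    p ∸ d + X + s        ≡⟨ cong (p ∸ d + X +_) (sym q+d≡s) ⟩
    p ∸ d + X + (q + d)  ≡⟨ shuffle (p ∸ d) X q d ⟩
    p ∸ d + d + (q + X)  ≡⟨ cong (_+ (q + X)) p∸d+d≡p ⟩
    p + (q + X)          ∎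
    where
    open ≡-Reasoning
    shuffle : ∀ a x q d → a + x + (q + d) ≡ a + d + (q + x)
    shuffle = solve-∀
  below : ∀ j → part (p ∸ d ∷ qs) j ≤ part (p ∷ q ∷ qs) j
  below zero    = m∸n≤m p d
  below (suc j) = proj₁ λ-part (suc j)
  shifted : ∀ j → part (p ∷ q ∷ qs) (suc j) ≤ part (p ∸ d ∷ qs) j
  shifted zero    = q≤p∸d
  shifted (suc j) = ≤-refl
  low : ∀ j → LowAt (p ∷ q ∷ qs) s (p ∸ d ∷ qs) j
  low zero    = inj₁ refl
  low (suc j) = inj₂ (regroup (topSize j qs))

removeStrip∷-spec : ∀ s p ps → IsPartition (p ∷ ps) → s ≤ p → StripRemoval (p ∷ ps) s (removeStrip∷ s p ps)
removeStrip∷-spec s p []       _      s≤p = oneRow-removal s p s≤p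
removeStrip∷-spec s p (q ∷ qs) λ-part s≤p with s ≤? q
... | yes s≤q = keep-first-row λ-part (removeStrip∷-spec s q qs (tail-partition λ-part) s≤q)
... | no  s≰q = shift-rows-up λ-part (≰⇒> s≰q) s≤p

removeStrip-spec : ∀ λ' s → IsPartition λ' → s ≤ part λ' 0 → StripRemoval λ' s (removeStrip λ' s)
removeStrip-spec [] s _ s≤0 rewrite n≤0⇒n≡0 s≤0 = record
  { partition = []-partition
  ; strip     = (λ _ → z≤n) , (λ _ → z≤n)
  ; size≡     = refl
  ; low       = λ _ → inj₁ refl
  }
removeStrip-spec (p ∷ ps) s = removeStrip∷-spec s p ps

addFirstRow : ℕ → List ℕ → List ℕ
addFirstRow r []       = oneRow r
addFirstRow r (p ∷ ps) = p + r ∷ ps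

addFirstRow-partition : ∀ r ν → IsPartition ν → IsPartition (addFirstRow r ν)
addFirstRow-partition r []       _      = oneRow-partition r
addFirstRow-partition r (p ∷ ps) ν-part =
  ∷-partition (≤-trans (head-positive ν-part) (m≤m+n p r)) (≤-trans (proj₁ ν-part 0) (m≤m+n p r))
              (tail-partition ν-part)

addFirstRow-strip : ∀ r ν → IsPartition ν → HorizontalStrip (addFirstRow r ν) ν
addFirstRow-strip r []       _      = (λ _ → z≤n) , (λ j → subst (_≤ 0) (sym (part-oneRow r (suc j))) z≤n)
addFirstRow-strip r (p ∷ ps) ν-part = below , proj₁ ν-part
  where
  below : ∀ j → part (p ∷ ps) j ≤ part (p + r ∷ ps) j
  below zero    = m≤m+n p r
  below (suc j) = ≤-refl

size-addFirstRow : ∀ r ν → size (addFirstRow r ν) ≡ size ν + r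
size-addFirstRow r []       = size-oneRow r
size-addFirstRow r (p ∷ ps) = xy∙z≈xz∙y p r (size ps)

topSize-addFirstRow : ∀ j r ν → topSize (suc j) (addFirstRow r ν) ≡ topSize (suc j) ν + r
topSize-addFirstRow j r []       = topSize-oneRow j r
topSize-addFirstRow j r (p ∷ ps) = xy∙z≈xz∙y p r (topSize j ps)

-- Sufficiency

≡ᵇ-refl : ∀ k → (k ≡ᵇ k) ≡ true
≡ᵇ-refl k with k ≡ᵇ k | ≡⇒≡ᵇ k k refl
... | true | _ = refl

≢⇒≡ᵇ-false : ∀ {i k} → i ≢ k → (i ≡ᵇ k) ≡ false
≢⇒≡ᵇ-false {i} {k} i≢k with i ≡ᵇ k | ≡ᵇ⇒≡ i k
... | false | _    = refl
... | true  | i≡k = contradiction (i≡k tt) i≢k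

_[_≔_] : (ℕ → Bool) → ℕ → Bool → ℕ → Bool
(J [ k ≔ b ]) i = if i ≡ᵇ k then b else J i

sumTo-select-≔ : ∀ k J b (f : ℕ → ℕ) →
                 sumTo (suc k) (select (J [ k ≔ b ]) f) ≡ sumTo k (select J f) + (if b then f k else 0)
sumTo-select-≔ k J b f = cong₂ _+_
  (sumTo-cong k (λ i i<k → cong (λ c → if c then f i else 0) (cong (if_then b else J i) (≢⇒≡ᵇ-false (<⇒≢ i<k)))))
  (cong (λ c → if (if c then b else J k) then f k else 0) (≡ᵇ-refl k))

only : ℕ → ℕ → Bool
only i j = j ≡ᵇ i

sumTo-only-≥ : ∀ {i k} (f : ℕ → ℕ) → k ≤ i → sumTo k (select (only i) f) ≡ 0
sumTo-only-≥ {i} {zero}  f _   = refl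
sumTo-only-≥ {i} {suc k} f k<i
  rewrite ≢⇒≡ᵇ-false (<⇒≢ k<i) = trans (+-identityʳ _) (sumTo-only-≥ f (<⇒≤ k<i))

sumTo-only : ∀ {i k} (f : ℕ → ℕ) → i < k → sumTo k (select (only i) f) ≡ f i
sumTo-only {i} {suc k} f (s≤s i≤k) with m≤n⇒m<n∨m≡n i≤k
... | inj₁ i<k rewrite ≢⇒≡ᵇ-false (>⇒≢ i<k) = trans (+-identityʳ _) (sumTo-only f i<k)
... | inj₂ refl rewrite ≡ᵇ-refl i | sumTo-only-≥ f (≤-refl {i}) = refl

sumTo-select-const : ∀ k J c → sumTo k (select J (λ _ → c)) ≡ count k J * c
sumTo-select-const zero    J c = refl
sumTo-select-const (suc k) J c with J k
... | true  = trans (cong (_+ c) (sumTo-select-const k J c))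
                    (sym (trans (*-distribʳ-+ c (count k J) 1) (cong (count k J * c +_) (*-identityˡ c))))
... | false = trans (+-identityʳ _) (trans (sumTo-select-const k J c) (cong (_* c) (sym (+-identityʳ (count k J)))))

maxTo : ℕ → (ℕ → ℕ) → ℕ
maxTo zero    f = 0
maxTo (suc k) f = maxTo k f ⊔ f k

maxTo-ub : ∀ {i k} (f : ℕ → ℕ) → i < k → f i ≤ maxTo k f
maxTo-ub {i} {suc k} f (s≤s i≤k) with m≤n⇒m<n∨m≡n i≤k
... | inj₁ i<k  = ≤-trans (maxTo-ub f i<k) (m≤m⊔n (maxTo k f) (f k))
... | inj₂ refl = m≤n⊔m (maxTo k f) (f i)

maxTo-+-lub : ∀ k (f : ℕ → ℕ) {x B} → x ≤ B → (∀ i → i < k → f i + x ≤ B) → maxTo k f + x ≤ B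
maxTo-+-lub zero    f x≤B _     = x≤B
maxTo-+-lub (suc k) f {x} x≤B bound =
  subst (_≤ _) (sym (+-distribʳ-⊔ x (maxTo k f) (f k)))
    (⊔-lub (maxTo-+-lub k f x≤B (λ i i<k → bound i (m≤n⇒m≤1+n i<k))) (bound k ≤-refl))

sumTo-select≤count*max : ∀ k J (f : ℕ → ℕ) → sumTo k (select J f) ≤ count k J * maxTo k f
sumTo-select≤count*max k J f =
  subst (sumTo k (select J f) ≤_) (sumTo-select-const k J (maxTo k f)) (sumTo-mono k pointwise)
  where
  pointwise : ∀ i → i < k → select J f i ≤ select J (λ _ → maxTo k f) i
  pointwise i i<k with J i
  ... | true  = maxTo-ub f i<k
  ... | false = z≤n

module _ {λ' t k} {a : ℕ → ℕ} (adm : Admissible λ' t (suc k) a) where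
  open Admissible adm

  without-last : ∀ J → sumTo k (select J a) ≤ bound λ' t (count k J)
  without-last J = subst₂ (λ σ c → σ ≤ bound λ' t c)
    (trans (sumTo-select-≔ k J false a) (+-identityʳ _))
    (trans (sumTo-select-≔ k J false (λ _ → 1)) (+-identityʳ _))
    (subset (J [ k ≔ false ]))

  with-last : ∀ J → sumTo k (select J a) + a k ≤ bound λ' t (suc (count k J))
  with-last J = subst₂ (λ σ c → σ ≤ bound λ' t c)
    (sumTo-select-≔ k J true a)
    (trans (sumTo-select-≔ k J true (λ _ → 1)) (+-comm (count k J) 1))
    (subset (J [ k ≔ true ]))

+-∸-≤ : ∀ {σ y L C} → σ ≤ C → σ + y ≤ C + L → σ + (y ∸ L) ≤ C
+-∸-≤ {σ} {y} {L} {C} σ≤C σ+y≤C+L with ≤-total y L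
... | inj₁ y≤L = subst (_≤ C) (sym (trans (cong (σ +_) (m≤n⇒m∸n≡0 y≤L)) (+-identityʳ σ))) σ≤C
... | inj₂ L≤y = +-cancelʳ-≤ L _ _
                   (subst (_≤ C + L) (sym (trans (+-assoc σ (y ∸ L) L) (cong (σ +_) (m∸n+n≡m L≤y)))) σ+y≤C+L)

topSize-suc≤ : ∀ λ' → IsPartition λ' → ∀ j → topSize (suc j) λ' ≤ topSize j λ' + topSize 1 λ'
topSize-suc≤ λ' λ-part j = begin
  topSize (suc j) λ'           ≡⟨ topSize-suc j λ' ⟩
  topSize j λ' + part λ' j     ≤⟨ +-monoʳ-≤ (topSize j λ') (part-antitone {λ'} λ-part z≤n) ⟩
  topSize j λ' + part λ' 0     ≡⟨ cong (topSize j λ' +_) (sym (topSize-one λ')) ⟩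
  topSize j λ' + topSize 1 λ'  ∎
  where open ≤-Reasoning

topSize-suc+≤ : ∀ λ' → IsPartition λ' → ∀ j → 1 ≤ j →
                topSize (suc j) λ' + topSize 1 λ' ≤ topSize j λ' + topSize 2 λ'
topSize-suc+≤ λ' λ-part j 1≤j = begin
  topSize (suc j) λ' + topSize 1 λ'          ≡⟨ cong (_+ topSize 1 λ') (topSize-suc j λ') ⟩
  topSize j λ' + part λ' j + topSize 1 λ'    ≤⟨ +-monoˡ-≤ (topSize 1 λ') (+-monoʳ-≤ (topSize j λ') λⱼ≤λ₂) ⟩
  topSize j λ' + part λ' 1 + topSize 1 λ'    ≡⟨ xy∙z≈x∙zy (topSize j λ') (part λ' 1) (topSize 1 λ') ⟩
  topSize j λ' + (topSize 1 λ' + part λ' 1)  ≡⟨ cong (topSize j λ' +_) (sym (topSize-suc 1 λ')) ⟩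
  topSize j λ' + topSize 2 λ'                ∎
  where
  open ≤-Reasoning
  λⱼ≤λ₂ : part λ' j ≤ part λ' 1
  λⱼ≤λ₂ = part-antitone {λ'} λ-part 1≤j

record OscStep (μ λ' : List ℕ) : Set where
  field
    mid              : List ℕ
    mid-partition    : IsPartition mid
    target-partition : IsPartition λ'
    down             : HorizontalStrip μ mid
    up               : HorizontalStrip λ' mid

stepSize : ∀ {μ λ'} → OscStep μ λ' → ℕ
stepSize {μ} {λ'} st = (size μ ∸ size mid) + (size λ' ∸ size mid)
  where open OscStep st

record Peeling (λ' : List ℕ) (t k : ℕ) (a : ℕ → ℕ) : Set where
  field
    μ            : List ℕ
    t′           : ℕ
    μ-partition  : IsPartition μ
    step         : OscStep μ λ'
    last         : stepSize step ≡ a k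
    admissible   : Admissible μ t′ k a

-- Undo the last step: remove a strip of s boxes from λ and add r boxes to the first row of the rest, with
-- r = max(a_k − λ₁, M + a_k − λ₁ − λ₂ − t) for M the largest of a_0, …, a_{k−1}, s = a_k − r and t′ = t − r.
module Peel {λ' t k} {a : ℕ → ℕ} (λ-part : IsPartition λ') (adm : Admissible λ' t (suc k) a) where
  open Admissible adm

  x M λ₁ λ₁₂ : ℕ
  x = a k
  M = maxTo k a
  λ₁ = topSize 1 λ'
  λ₁₂ = topSize 2 λ'

  single-bound : ∀ i → i < suc k → a i ≤ λ₁ + t
  single-bound i i<k = subst₂ (λ σ c → σ ≤ bound λ' t c) (sumTo-only a i<k) (sumTo-only (λ _ → 1) i<k) (subset (only i))

  pair-bound : ∀ i → i < k → a i + x ≤ λ₁₂ + (t + t)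
  pair-bound i i<k = subst₂ (λ σ c → σ + x ≤ bound λ' t (suc c)) (sumTo-only a i<k) (sumTo-only (λ _ → 1) i<k)
                       (with-last adm (only i))

  λ₁≤λ₁₂ : λ₁ ≤ λ₁₂
  λ₁≤λ₁₂ = subst (λ₁ ≤_) (sym (topSize-suc 1 λ')) (m≤m+n λ₁ (part λ' 1))

  x≤λ₁+t : x ≤ λ₁ + t
  x≤λ₁+t = single-bound k ≤-refl

  M≤λ₁+t : M ≤ λ₁ + t
  M≤λ₁+t = subst (_≤ λ₁ + t) (+-identityʳ M)
    (maxTo-+-lub k a z≤n (λ i i<k → subst (_≤ λ₁ + t) (sym (+-identityʳ (a i))) (single-bound i (m≤n⇒m≤1+n i<k))))

  M+x≤ : M + x ≤ λ₁₂ + (t + t)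
  M+x≤ = maxTo-+-lub k a (≤-trans x≤λ₁+t (+-mono-≤ λ₁≤λ₁₂ (m≤m+n t t))) pair-bound

  A B r s t′ : ℕ
  A = x ∸ λ₁
  B = (M + x) ∸ (λ₁₂ + t)
  r = A ⊔ B
  s = x ∸ r
  t′ = t ∸ r

  r≤t : r ≤ t
  r≤t = ⊔-lub (m≤n+o⇒m∸n≤o x λ₁ x≤λ₁+t)
              (m≤n+o⇒m∸n≤o (M + x) (λ₁₂ + t) (subst (M + x ≤_) (sym (+-assoc λ₁₂ t t)) M+x≤))

  r≤x : r ≤ x
  r≤x = ⊔-lub (m∸n≤m x λ₁)
              (m≤n+o⇒m∸n≤o (M + x) (λ₁₂ + t) (+-monoˡ-≤ x (≤-trans M≤λ₁+t (+-monoˡ-≤ t λ₁≤λ₁₂))))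

  r+s≡x : r + s ≡ x
  r+s≡x = m+[n∸m]≡n r≤x

  r+t′≡t : r + t′ ≡ t
  r+t′≡t = m+[n∸m]≡n r≤t

  M+x≤λ₁₂+t+r : M + x ≤ λ₁₂ + t + r
  M+x≤λ₁₂+t+r = ≤-trans (m≤n+m∸n (M + x) (λ₁₂ + t)) (+-monoʳ-≤ (λ₁₂ + t) (m≤n⊔m A B))

  s≤λ₁ : s ≤ part λ' 0
  s≤λ₁ = subst (s ≤_) (topSize-one λ')
    (m≤n+o⇒m∸n≤o x r (≤-trans (m≤n+m∸n x λ₁) (subst (λ₁ + A ≤_) (+-comm λ₁ r) (+-monoʳ-≤ λ₁ (m≤m⊔n A B)))))

  ν μ : List ℕ
  ν = removeStrip λ' s
  μ = addFirstRow r ν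

  module R = StripRemoval (removeStrip-spec λ' s λ-part s≤λ₁)

  settle : ∀ σ T → σ + r ≤ T + (t + t) → σ ≤ T + r + (t′ + t′)
  settle σ T σ+r≤ = +-cancelʳ-≤ r σ _ (begin
    σ + r                      ≤⟨ σ+r≤ ⟩
    T + (t + t)                ≡⟨ cong (λ u → T + (u + u)) (sym r+t′≡t) ⟩
    T + ((r + t′) + (r + t′))  ≡⟨ shuffle T r t′ ⟩
    T + r + (t′ + t′) + r      ∎)
    where
    open ≤-Reasoning
    shuffle : ∀ T r t → T + ((r + t) + (r + t)) ≡ T + r + (t + t) + r
    shuffle = solve-∀

  first-row-bound : ∀ σ → σ ≤ λ₁ + t → σ ≤ M → σ ≤ topSize 1 ν + r + t′
  first-row-bound σ σ≤ σ≤M with R.low 1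
  ... | inj₁ same = begin
    σ                       ≤⟨ σ≤ ⟩
    λ₁ + t                  ≡⟨ cong₂ _+_ (sym same) (sym r+t′≡t) ⟩
    topSize 1 ν + (r + t′)  ≡⟨ sym (+-assoc _ r t′) ⟩
    topSize 1 ν + r + t′    ∎
    where open ≤-Reasoning
  ... | inj₂ shifted = ≤-trans σ≤M (+-cancelʳ-≤ (r + s) M _ (begin
    M + (r + s)                     ≡⟨ cong (M +_) r+s≡x ⟩
    M + x                           ≤⟨ M+x≤λ₁₂+t+r ⟩
    λ₁₂ + t + r                     ≡⟨ cong (λ u → u + t + r) (sym shifted) ⟩
    topSize 1 ν + s + t + r         ≡⟨ cong (λ u → topSize 1 ν + s + u + r) (sym r+t′≡t) ⟩
    topSize 1 ν + s + (r + t′) + r  ≡⟨ shuffle (topSize 1 ν) s r t′ ⟩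
    topSize 1 ν + r + t′ + (r + s)  ∎))
    where
    open ≤-Reasoning
    shuffle : ∀ T s r t → T + s + (r + t) + r ≡ T + r + t + (r + s)
    shuffle = solve-∀

  module _ (j σ : ℕ) (σ≤ : σ ≤ topSize (2 + j) λ' + (t + t)) (σ+x≤ : σ + x ≤ topSize (3 + j) λ' + (t + t)) where
    private
      open ≤-Reasoning
      C : ℕ
      C = topSize (2 + j) λ' + (t + t)

    +A≤ : σ + A ≤ C
    +A≤ = +-∸-≤ σ≤ (begin
      σ + x                              ≤⟨ σ+x≤ ⟩
      topSize (3 + j) λ' + (t + t)       ≤⟨ +-monoˡ-≤ (t + t) (topSize-suc≤ λ' λ-part (2 + j)) ⟩
      topSize (2 + j) λ' + λ₁ + (t + t)  ≡⟨ xy∙z≈xz∙y (topSize (2 + j) λ') λ₁ (t + t) ⟩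
      C + λ₁                             ∎)

    +B≤ : σ + B ≤ C
    +B≤ = +-∸-≤ σ≤ (begin
      σ + (M + x)                                   ≡⟨ x∙yz≈y∙xz σ M x ⟩
      M + (σ + x)                                   ≤⟨ +-mono-≤ M≤λ₁+t σ+x≤ ⟩
      λ₁ + t + (topSize (3 + j) λ' + (t + t))       ≡⟨ shuffle₁ λ₁ t (topSize (3 + j) λ') ⟩
      topSize (3 + j) λ' + λ₁ + (t + t) + t         ≤⟨ +-monoˡ-≤ t (+-monoˡ-≤ (t + t) λ-step) ⟩
      topSize (2 + j) λ' + λ₁₂ + (t + t) + t        ≡⟨ shuffle₂ (topSize (2 + j) λ') λ₁₂ t ⟩
      C + (λ₁₂ + t)                                 ∎)
      where
      λ-step : topSize (3 + j) λ' + λ₁ ≤ topSize (2 + j) λ' + λ₁₂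
      λ-step = topSize-suc+≤ λ' λ-part (2 + j) (s≤s z≤n)
      shuffle₁ : ∀ l t L → l + t + (L + (t + t)) ≡ L + l + (t + t) + t
      shuffle₁ = solve-∀
      shuffle₂ : ∀ T l t → T + l + (t + t) + t ≡ T + (t + t) + (l + t)
      shuffle₂ = solve-∀

    lower-rows-bound : σ + r ≤ topSize (2 + j) ν + (t + t)
    lower-rows-bound with R.low (2 + j)
    ... | inj₁ same = subst (λ T → σ + r ≤ T + (t + t)) (sym same)
      (subst (_≤ C) (sym (+-distribˡ-⊔ σ A B)) (⊔-lub +A≤ +B≤))
    ... | inj₂ shifted = +-cancelʳ-≤ s _ _ (begin
      σ + r + s                       ≡⟨ +-assoc σ r s ⟩
      σ + (r + s)                     ≡⟨ cong (σ +_) r+s≡x ⟩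
      σ + x                           ≤⟨ σ+x≤ ⟩
      topSize (3 + j) λ' + (t + t)    ≡⟨ cong (_+ (t + t)) (sym shifted) ⟩
      topSize (2 + j) ν + s + (t + t) ≡⟨ xy∙z≈xz∙y (topSize (2 + j) ν) s (t + t) ⟩
      topSize (2 + j) ν + (t + t) + s ∎)

  bound-peeled : ∀ j σ → σ ≤ bound λ' t j → σ + x ≤ bound λ' t (suc j) → σ ≤ j * M → σ ≤ bound μ t′ j
  bound-peeled zero          σ σ≤ _    _     = σ≤
  bound-peeled (suc zero)    σ σ≤ _    σ≤1*M =
    subst (σ ≤_) (sym (cong (_+ t′) (topSize-addFirstRow 0 r ν)))
          (first-row-bound σ σ≤ (subst (σ ≤_) (+-identityʳ M) σ≤1*M))
  bound-peeled (suc (suc j)) σ σ≤ σ+x≤ _     =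
    subst (σ ≤_) (sym (cong (_+ (t′ + t′)) (topSize-addFirstRow (suc j) r ν)))
          (settle σ (topSize (2 + j) ν) (lower-rows-bound j σ σ≤ σ+x≤))

  total′ : sumTo k a ≡ size μ + (t′ + t′)
  total′ = +-cancelʳ-≡ x _ _ (begin
    sumTo k a + x                       ≡⟨ total ⟩
    size λ' + (t + t)                   ≡⟨ cong₂ (λ n u → n + (u + u)) R.size≡ (sym r+t′≡t) ⟩
    size ν + s + ((r + t′) + (r + t′))  ≡⟨ shuffle (size ν) s r t′ ⟩
    size ν + r + (t′ + t′) + (r + s)    ≡⟨ cong₂ (λ n y → n + (t′ + t′) + y) (sym (size-addFirstRow r ν)) r+s≡x ⟩
    size μ + (t′ + t′) + x              ∎)
    where
    open ≡-Reasoning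
    shuffle : ∀ n s r t → n + s + ((r + t) + (r + t)) ≡ n + r + (t + t) + (r + s)
    shuffle = solve-∀

  last : (size μ ∸ size ν) + (size λ' ∸ size ν) ≡ x
  last = trans (cong₂ _+_ (trans (cong (_∸ size ν) (size-addFirstRow r ν)) (m+n∸m≡n (size ν) r))
                          (trans (cong (_∸ size ν) R.size≡) (m+n∸m≡n (size ν) s)))
               r+s≡x

  peeling : Peeling λ' t k a
  peeling = record
    { μ           = μ
    ; t′          = t′
    ; μ-partition = addFirstRow-partition r ν R.partition
    ; step        = record
      { mid = ν ; mid-partition = R.partition ; target-partition = λ-part
      ; down = addFirstRow-strip r ν R.partition ; up = R.strip }
    ; last        = last
    ; admissible  = record
      { total  = total′
      ; subset = λ J → bound-peeled (count k J) _ (without-last adm J) (with-last adm J) (sumTo-select≤count*max k J a)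
      }
    }

data Oscillation : List ℕ → List ℕ → Set where
  stay : ∀ {λ'} → IsPartition λ' → Oscillation λ' λ'
  _∷_  : ∀ {μ ν λ'} → OscStep μ ν → Oscillation ν λ' → Oscillation μ λ'

shape : ∀ {μ λ'} → Oscillation μ λ' → ℕ → List ℕ
shape {μ} o         zero    = μ
shape {μ} (stay _)  (suc i) = μ
shape     (_ ∷ o)   (suc i) = shape o i

middle : ∀ {μ λ'} → Oscillation μ λ' → ℕ → List ℕ
middle {μ} (stay _) i       = μ
middle     (st ∷ o) zero    = OscStep.mid st
middle     (st ∷ o) (suc i) = middle o i

stepSizeAt : ∀ {μ λ'} → Oscillation μ λ' → ℕ → ℕ
stepSizeAt o i = (size (shape o i) ∸ size (middle o i)) + (size (shape o (suc i)) ∸ size (middle o i))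

duration : ∀ {μ λ'} → Oscillation μ λ' → ℕ
duration (stay _) = 0
duration (_ ∷ o)  = suc (duration o)

stepSizeAt-stay : ∀ {λ'} (λ-part : IsPartition λ') i → stepSizeAt (stay {λ'} λ-part) i ≡ 0
stepSizeAt-stay {λ'} λ-part zero    = cong₂ _+_ (n∸n≡0 (size λ')) (n∸n≡0 (size λ'))
stepSizeAt-stay {λ'} λ-part (suc i) = cong₂ _+_ (n∸n≡0 (size λ')) (n∸n≡0 (size λ'))

shape-final : ∀ {μ λ'} (o : Oscillation μ λ') i → duration o ≤ i → shape o i ≡ λ'
shape-final (stay _) zero    _         = refl
shape-final (stay _) (suc i) _         = refl
shape-final (_ ∷ o)  (suc i) (s≤s l≤i) = shape-final o i l≤i

middle-final : ∀ {μ λ'} (o : Oscillation μ λ') i → duration o ≤ i → middle o i ≡ λ'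
middle-final (stay _) i       _         = refl
middle-final (_ ∷ o)  (suc i) (s≤s l≤i) = middle-final o i l≤i

shape-partition : ∀ {μ λ'} → IsPartition μ → (o : Oscillation μ λ') → ∀ i → IsPartition (shape o i)
shape-partition μ-part o        zero    = μ-part
shape-partition μ-part (stay _) (suc i) = μ-part
shape-partition μ-part (st ∷ o) (suc i) = shape-partition (OscStep.target-partition st) o i

middle-partition : ∀ {μ λ'} (o : Oscillation μ λ') i → IsPartition (middle o i)
middle-partition (stay λ-part) i       = λ-part
middle-partition (st ∷ o)      zero    = OscStep.mid-partition st
middle-partition (st ∷ o)      (suc i) = middle-partition o i

down-strip : ∀ {μ λ'} (o : Oscillation μ λ') i → HorizontalStrip (shape o i) (middle o i)
down-strip (stay {μ} μ-part) zero    = strip-refl {μ} μ-part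
down-strip (stay {μ} μ-part) (suc i) = strip-refl {μ} μ-part
down-strip (st ∷ o)          zero    = OscStep.down st
down-strip (st ∷ o)          (suc i) = down-strip o i

up-strip : ∀ {μ λ'} (o : Oscillation μ λ') i → HorizontalStrip (shape o (suc i)) (middle o i)
up-strip (stay {λ'} λ-part) i       = strip-refl {λ'} λ-part
up-strip (st ∷ o)           zero    = OscStep.up st
up-strip (st ∷ o)           (suc i) = up-strip o i

first-middle : ∀ {λ'} (o : Oscillation [] λ') → middle o 0 ≡ []
first-middle (stay _) = refl
first-middle (st ∷ o) = size≡0⇒≡[] mid-partition (n≤0⇒n≡0 (size-mono mid [] (proj₁ down)))
  where open OscStep st

toSSOT : ∀ {λ'} → Oscillation [] λ' → SSOT λ'
toSSOT o = record
  { S       = shape o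
  ; S'      = λ { zero → [] ; (suc i) → middle o i }
  ; S-part  = shape-partition []-partition o
  ; S'-part = middle-partition o
  ; S0      = refl
  ; S'1     = first-middle o
  ; strip₁  = down-strip o
  ; strip₂  = up-strip o
  ; stable  = duration o , λ i l≤i → shape-final o i l≤i , middle-final o i l≤i
  }

record Completion {μ λ'} (k : ℕ) (a : ℕ → ℕ) (o : Oscillation μ λ') : Set where
  field
    whole  : Oscillation [] λ'
    prefix : ∀ i → i < k → stepSizeAt whole i ≡ a i
    suffix : ∀ i → stepSizeAt whole (k + i) ≡ stepSizeAt o i

complete : ∀ k {μ t λ'} {a : ℕ → ℕ} → IsPartition μ → Admissible μ t k a →
           (o : Oscillation μ λ') → Completion k a o
complete zero    {μ} μ-part adm o with size≡0⇒≡[] {μ} μ-part (m+n≡0⇒m≡0 _ (sym (Admissible.total adm)))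
... | refl = record { whole = o ; prefix = λ _ () ; suffix = λ _ → refl }
complete (suc k) {a = a} μ-part adm o = record { whole = whole ; prefix = prefix′ ; suffix = suffix′ }
  where
  open Peeling (Peel.peeling μ-part adm)
  completed : Completion k a (step ∷ o)
  completed = complete k μ-partition admissible (step ∷ o)
  open Completion completed
  prefix′ : ∀ i → i < suc k → stepSizeAt whole i ≡ a i
  prefix′ i (s≤s i≤k) with m≤n⇒m<n∨m≡n i≤k
  ... | inj₁ i<k  = prefix i i<k
  ... | inj₂ refl = trans (cong (stepSizeAt whole) (sym (+-identityʳ i))) (trans (suffix 0) last)
  suffix′ : ∀ i → stepSizeAt whole (suc k + i) ≡ stepSizeAt o i
  suffix′ i = trans (cong (stepSizeAt whole) (sym (+-suc k i))) (suffix (suc i))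

admissible⇒support : ∀ {λ' n k t} {a : Fin k → ℕ} → IsPartition λ' → n ≡ size λ' + (t + t) →
                     Admissible λ' t k (extend k a) → InSupp λ' n k a
admissible⇒support {λ'} {n} {k} {t} {a} λ-part n≡ adm = toSSOT whole , m≡a , idle , Σa≡n
  where
  completed : Completion k (extend k a) (stay {λ'} λ-part)
  completed = complete k λ-part adm (stay {λ'} λ-part)
  open Completion completed
  m≡a : ∀ (i : Fin k) → m (toSSOT whole) (suc (toℕ i)) ≡ a i
  m≡a i = trans (prefix (toℕ i) (toℕ<n i)) (extend-toℕ k a i)
  idle : ∀ i → k < i → m (toSSOT whole) i ≡ 0
  idle (suc i) (s≤s k≤i) = begin
    stepSizeAt whole i                     ≡⟨ cong (stepSizeAt whole) (sym (m+[n∸m]≡n k≤i)) ⟩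
    stepSizeAt whole (k + (i ∸ k))         ≡⟨ suffix (i ∸ k) ⟩
    stepSizeAt (stay {λ'} λ-part) (i ∸ k)  ≡⟨ stepSizeAt-stay {λ'} λ-part (i ∸ k) ⟩
    0                                      ∎
    where open ≡-Reasoning
  Σa≡n : sumFin k a ≡ n
  Σa≡n = trans (sym (sumTo-extend k a)) (trans (Admissible.total adm) (sym n≡))


-- Convex combinations

toℚ≡mkℚ : ∀ n → toℚ n ≡ ℚ.mkℚ (ℤ.+ n) 0 (Coprime.sym (Coprime.1-coprimeTo n))
toℚ≡mkℚ n = ℚ.normalize-coprime (Coprime.sym (Coprime.1-coprimeTo n))

toℚ-+ : ∀ m n → toℚ (m + n) ≡ toℚ m ℚ.+ toℚ n
toℚ-+ m n = ℚ.toℚᵘ-injective (ℚᵘ.≃-trans homo (ℚᵘ.≃-sym (ℚ.toℚᵘ-homo-+ (toℚ m) (toℚ n))))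
  where
  homo : ℚ.toℚᵘ (toℚ (m + n)) ℚᵘ.≃ ℚ.toℚᵘ (toℚ m) ℚᵘ.+ ℚ.toℚᵘ (toℚ n)
  homo rewrite toℚ≡mkℚ (m + n) | toℚ≡mkℚ m | toℚ≡mkℚ n = ℚᵘ.*≡* (begin
    ℤ.+ (m + n) ℤ.* ℤ.+ 1                             ≡⟨ ℤ.*-identityʳ _ ⟩
    ℤ.+ (m + n)                                       ≡⟨ ℤ.pos-+ m n ⟩
    ℤ.+ m ℤ.+ ℤ.+ n                                   ≡⟨ sym (cong₂ ℤ._+_ (ℤ.*-identityʳ (ℤ.+ m)) (ℤ.*-identityʳ (ℤ.+ n))) ⟩
    ℤ.+ m ℤ.* ℤ.+ 1 ℤ.+ ℤ.+ n ℤ.* ℤ.+ 1               ≡⟨ sym (ℤ.*-identityʳ _) ⟩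
    (ℤ.+ m ℤ.* ℤ.+ 1 ℤ.+ ℤ.+ n ℤ.* ℤ.+ 1) ℤ.* ℤ.+ 1   ∎)
    where open ≡-Reasoning

toℚ-mono-≤ : ∀ {m n} → m ≤ n → toℚ m ℚ.≤ toℚ n
toℚ-mono-≤ {m} {n} m≤n rewrite toℚ≡mkℚ m | toℚ≡mkℚ n = ℚ.*≤* (ℤ.*-monoʳ-≤-nonNeg (ℤ.+ 1) (ℤ.+≤+ m≤n))

toℚ-cancel-≤ : ∀ {m n} → toℚ m ℚ.≤ toℚ n → m ≤ n
toℚ-cancel-≤ {m} {n} m≤n rewrite toℚ≡mkℚ m | toℚ≡mkℚ n with m≤n
... | ℚ.*≤* m*1≤n*1 = ℤ.drop‿+≤+ (subst₂ ℤ._≤_ (ℤ.*-identityʳ (ℤ.+ m)) (ℤ.*-identityʳ (ℤ.+ n)) m*1≤n*1)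

toℚ-injective : ∀ {m n} → toℚ m ≡ toℚ n → m ≡ n
toℚ-injective m≡n = ≤-antisym (toℚ-cancel-≤ (ℚ.≤-reflexive m≡n)) (toℚ-cancel-≤ (ℚ.≤-reflexive (sym m≡n)))

module _ {A : Set} where

  sumℚ-+ : ∀ (f g : A → ℚ) xs → sumℚ (map (λ x → f x ℚ.+ g x) xs) ≡ sumℚ (map f xs) ℚ.+ sumℚ (map g xs)
  sumℚ-+ f g []       = sym (ℚ.+-identityʳ 0ℚ)
  sumℚ-+ f g (x ∷ xs) = trans (cong (f x ℚ.+ g x ℚ.+_) (sumℚ-+ f g xs)) (ℚ+.interchange (f x) (g x) _ _)

  sumℚ-*ʳ : ∀ (w : A → ℚ) q xs → sumℚ (map (λ x → w x ℚ.* q) xs) ≡ sumℚ (map w xs) ℚ.* q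
  sumℚ-*ʳ w q []       = sym (ℚ.*-zeroˡ q)
  sumℚ-*ʳ w q (x ∷ xs) = trans (cong (w x ℚ.* q ℚ.+_) (sumℚ-*ʳ w q xs)) (sym (ℚ.*-distribʳ-+ q (w x) _))

  sumℚ-mono : ∀ {f g : A → ℚ} {xs} → All (λ x → f x ℚ.≤ g x) xs → sumℚ (map f xs) ℚ.≤ sumℚ (map g xs)
  sumℚ-mono []            = ℚ.≤-refl
  sumℚ-mono (f≤g ∷ fs≤gs) = ℚ.+-mono-≤ f≤g (sumℚ-mono fs≤gs)

  sumℚ-cong : ∀ {f g : A → ℚ} xs → (∀ x → f x ≡ g x) → sumℚ (map f xs) ≡ sumℚ (map g xs)
  sumℚ-cong xs f≡g = cong sumℚ (map-cong f≡g xs)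

  sumℚ-cong-All : ∀ {f g : A → ℚ} {xs} → All (λ x → f x ≡ g x) xs → sumℚ (map f xs) ≡ sumℚ (map g xs)
  sumℚ-cong-All []            = refl
  sumℚ-cong-All (f≡g ∷ fs≡gs) = cong₂ ℚ._+_ f≡g (sumℚ-cong-All fs≡gs)

  module _ (w : A → ℚ) {xs : List A} (Σw≡1 : sumℚ (map w xs) ≡ 1ℚ) where

    average-const : ∀ q → sumℚ (map (λ x → w x ℚ.* q) xs) ≡ q
    average-const q = trans (sumℚ-*ʳ w q xs) (trans (cong (ℚ._* q) Σw≡1) (ℚ.*-identityˡ q))

    average-≤ : ∀ (g : A → ℚ) q → All (λ x → 0ℚ ℚ.≤ w x × g x ℚ.≤ q) xs →
                sumℚ (map (λ x → w x ℚ.* g x) xs) ℚ.≤ q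
    average-≤ g q bounded = ℚ.≤-trans (sumℚ-mono (All.map scale bounded)) (ℚ.≤-reflexive (average-const q))
      where
      scale : ∀ {x} → 0ℚ ℚ.≤ w x × g x ℚ.≤ q → w x ℚ.* g x ℚ.≤ w x ℚ.* q
      scale {x} (0≤w , g≤q) = ℚ.*-monoˡ-≤-nonNeg (w x) {{ℚ.nonNegative 0≤w}} g≤q

module _ {A : Set} (w : A → ℚ) (xs : List A) where

  sumℚ-*0 : sumℚ (map (λ x → w x ℚ.* toℚ 0) xs) ≡ 0ℚ
  sumℚ-*0 = trans (sumℚ-*ʳ w 0ℚ xs) (ℚ.*-zeroʳ (sumℚ (map w xs)))

  toℚ-subsetSum : ∀ k J (a : Fin k → ℕ) (p : A → Fin k → ℕ) →
                  (∀ j → toℚ (a j) ≡ sumℚ (map (λ x → w x ℚ.* toℚ (p x j)) xs)) →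
                  toℚ (subsetSum k J a) ≡ sumℚ (map (λ x → w x ℚ.* toℚ (subsetSum k J (p x))) xs)
  toℚ-subsetSum zero    J a p _  = sym sumℚ-*0
  toℚ-subsetSum (suc k) J a p a≡ = begin
    toℚ (subsetSum (suc k) J a)
      ≡⟨ cong toℚ (sumFin-suc k (selectFin a)) ⟩
    toℚ (first a + rest a)
      ≡⟨ toℚ-+ (first a) (rest a) ⟩
    toℚ (first a) ℚ.+ toℚ (rest a)
      ≡⟨ cong₂ ℚ._+_ first-linear rest-linear ⟩
    sumℚ (map (λ x → w x ℚ.* toℚ (first (p x))) xs) ℚ.+ sumℚ (map (λ x → w x ℚ.* toℚ (rest (p x))) xs)
      ≡⟨ sym (sumℚ-+ (λ x → w x ℚ.* toℚ (first (p x))) (λ x → w x ℚ.* toℚ (rest (p x))) xs) ⟩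
    sumℚ (map (λ x → w x ℚ.* toℚ (first (p x)) ℚ.+ w x ℚ.* toℚ (rest (p x))) xs)
      ≡⟨ sumℚ-cong xs (λ x → trans (sym (ℚ.*-distribˡ-+ (w x) _ _)) (cong (w x ℚ.*_) (sym (toℚ-+ (first (p x)) (rest (p x)))))) ⟩
    sumℚ (map (λ x → w x ℚ.* toℚ (first (p x) + rest (p x))) xs)
      ≡⟨ sumℚ-cong xs (λ x → cong (λ n → w x ℚ.* toℚ n) (sym (sumFin-suc k (selectFin (p x))))) ⟩
    sumℚ (map (λ x → w x ℚ.* toℚ (subsetSum (suc k) J (p x))) xs) ∎
    where
    open ≡-Reasoning
    selectFin : (Fin (suc k) → ℕ) → Fin (suc k) → ℕ
    selectFin v j = if J (toℕ j) then v j else 0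
    first : (Fin (suc k) → ℕ) → ℕ
    first v = if J 0 then v Fin.zero else 0
    rest : (Fin (suc k) → ℕ) → ℕ
    rest v = subsetSum k (J ∘ suc) (v ∘ Fin.suc)
    first-linear : toℚ (first a) ≡ sumℚ (map (λ x → w x ℚ.* toℚ (first (p x))) xs)
    first-linear with J 0
    ... | true  = a≡ Fin.zero
    ... | false = sym sumℚ-*0
    rest-linear : toℚ (rest a) ≡ sumℚ (map (λ x → w x ℚ.* toℚ (rest (p x))) xs)
    rest-linear = toℚ-subsetSum k (J ∘ suc) (a ∘ Fin.suc) (λ x → p x ∘ Fin.suc) (a≡ ∘ Fin.suc)

convex-admissible : ∀ {λ' t k} (ws : List (ℚ × (Fin k → ℕ))) {a : Fin k → ℕ} →
                    All (λ wp → 0ℚ ℚ.≤ proj₁ wp × Admissible λ' t k (extend k (proj₂ wp))) ws →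
                    sumℚ (map proj₁ ws) ≡ 1ℚ →
                    (∀ j → sumℚ (map (λ wp → proj₁ wp ℚ.* toℚ (proj₂ wp j)) ws) ≡ toℚ (a j)) →
                    Admissible λ' t k (extend k a)
convex-admissible {λ'} {t} {k} ws {a} points Σw≡1 Σwp≡a = record
  { total  = trans (sumTo-select-extend k (λ _ → true) a) (toℚ-injective total-ℚ)
  ; subset = λ J → subst (_≤ bound λ' t (count k J)) (sym (sumTo-select-extend k J a)) (toℚ-cancel-≤ (subset-ℚ J))
  }
  where
  linear : ∀ J → toℚ (subsetSum k J a) ≡ sumℚ (map (λ wp → proj₁ wp ℚ.* toℚ (subsetSum k J (proj₂ wp))) ws)
  linear J = toℚ-subsetSum proj₁ ws k J a proj₂ (λ j → sym (Σwp≡a j))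

  total-ℚ : toℚ (subsetSum k (λ _ → true) a) ≡ toℚ (size λ' + (t + t))
  total-ℚ = trans (linear (λ _ → true))
                  (trans (sumℚ-cong-All (All.map total-at points)) (average-const proj₁ {ws} Σw≡1 _))
    where
    total-at : ∀ {wp} → 0ℚ ℚ.≤ proj₁ wp × Admissible λ' t k (extend k (proj₂ wp)) →
               proj₁ wp ℚ.* toℚ (subsetSum k (λ _ → true) (proj₂ wp)) ≡ proj₁ wp ℚ.* toℚ (size λ' + (t + t))
    total-at {w , p} (_ , adm) =
      cong (λ n → w ℚ.* toℚ n) (trans (sym (sumTo-select-extend k (λ _ → true) p)) (Admissible.total adm))

  subset-ℚ : ∀ J → toℚ (subsetSum k J a) ℚ.≤ toℚ (bound λ' t (count k J))
  subset-ℚ J = ℚ.≤-trans (ℚ.≤-reflexive (linear J)) (average-≤ proj₁ {ws} Σw≡1 _ _ (All.map bounded points))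
    where
    bounded : ∀ {wp} → 0ℚ ℚ.≤ proj₁ wp × Admissible λ' t k (extend k (proj₂ wp)) →
              0ℚ ℚ.≤ proj₁ wp × toℚ (subsetSum k J (proj₂ wp)) ℚ.≤ toℚ (bound λ' t (count k J))
    bounded {_ , p} (0≤w , adm) =
      0≤w , toℚ-mono-≤ (subst (_≤ bound λ' t (count k J)) (sumTo-select-extend k J p) (Admissible.subset adm J))

theorem4p19 : (lam : List ℕ) → IsPartition lam → (n : ℕ) → InN lam n →
    (k : ℕ) → 1 ≤ k → (a : Fin k → ℕ) →
    (InConvexHull k (InSupp lam n k) a → InSupp lam n k a)
    × (InSupp lam n k a → InConvexHull k (InSupp lam n k) a)
theorem4p19 lam lam-part n _ k _ a = hull⇒support , support⇒hull
  where
  support⇒hull : InSupp lam n k a → InConvexHull k (InSupp lam n k) a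
  support⇒hull a∈supp = (1ℚ , a) ∷ [] , (ℚ.nonNegative⁻¹ 1ℚ , a∈supp) ∷ [] , ℚ.+-identityʳ 1ℚ ,
                        λ j → trans (ℚ.+-identityʳ _) (ℚ.*-identityˡ _)

  hull⇒support : InConvexHull k (InSupp lam n k) a → InSupp lam n k a
  hull⇒support ([] , _ , () , _)
  hull⇒support (ws@(_ ∷ _) , points@((_ , p₀∈supp) ∷ _) , Σw≡1 , Σwp≡a) with support⇒admissible p₀∈supp
  ... | t , n≡ , _ = admissible⇒support lam-part n≡
    (convex-admissible ws (All.map (λ (0≤w , p∈supp) → 0≤w , support⇒admissible-at t n≡ p∈supp) points)
                       Σw≡1 Σwp≡a)
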